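{- Let $p, q \geq 1$ be integers and let $\Sigma$ be an alphabet with at least four symbols. There exists an adversary for the $2p \times 2q$ grid over $\Sigma$: a strategy that answers, adaptively, each query of a previously unqueried cell with a symbol of $\Sigma$, such that for every order in which the cells are queried, after each query that leaves at least one cell unread, the answers given so far can be extended to a coloring $c : [2p]\times[2q] \to \Sigma$ whose grid graph $G_c$ contains a cycle and also to a coloring whose grid graph is acyclic.
   Context: For a coloring $c : [m] \times [n] \to \Sigma$, the grid graph $G_c$ has vertex set $[m] \times [n]$ and an edge between $(i,j)$ and $(i',j')$ iff $|i-i'|+|j-j'|=1$ and $c(i,j)=c(i',j')$. The query order may be chosen adaptively by the querier depending on previous answers. -}

module Defs where

open import Data.Nat using (ℕ; suc; _+_; _*_; _≤_; _<_; ∣_-_∣)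
open import Data.Fin using (Fin; toℕ)
open import Data.Product using (_×_; _,_; ∃; ∃-syntax)
open import Data.List using (List; []; _∷_; _++_; [_]; length)
open import Data.List.Membership.Propositional using (_∈_)
open import Data.List.Relation.Unary.Unique.Propositional using (Unique)
open import Data.List.Relation.Unary.Linked using (Linked)
open import Relation.Binary.PropositionalEquality using (_≡_)
open import Relation.Nullary using (¬_)

Cell : ℕ → ℕ → Set
Cell m n = Fin m × Fin n

Coloring : ℕ → ℕ → Set → Set
Coloring m n Σ = Cell m n → Σ

GridAdj : ∀ {m n} → Cell m n → Cell m n → Set
GridAdj (i , j) (i' , j') = ∣ toℕ i - toℕ i' ∣ + ∣ toℕ j - toℕ j' ∣ ≡ 1

Edge : ∀ {m n Σ} → Coloring m n Σ → Cell m n → Cell m n → Set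
Edge c u v = GridAdj u v × c u ≡ c v

-- G_c contains a cycle: distinct vertices v, v₁, …, v_k with k ≥ 2
-- (so at least 3 vertices), consecutive ones adjacent in G_c and v_k adjacent to v.
HasCycle : ∀ {m n Σ} → Coloring m n Σ → Set
HasCycle {m} {n} c =
  ∃[ v ] ∃[ vs ] (Unique (v ∷ vs) × 2 ≤ length vs × Linked (Edge c) (v ∷ vs ++ [ v ]))

Acyclic : ∀ {m n Σ} → Coloring m n Σ → Set
Acyclic c = ¬ HasCycle c

History : ℕ → ℕ → Set → Set
History m n Σ = List (Cell m n × Σ)

Adversary : ℕ → ℕ → Set → Set
Adversary m n Σ = History m n Σ → Cell m n → Σ

runFrom : ∀ {m n Σ} → Adversary m n Σ → History m n Σ → List (Cell m n) → History m n Σ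
runFrom A h [] = h
runFrom A h (x ∷ xs) = runFrom A (h ++ [ (x , A h x) ]) xs

run : ∀ {m n Σ} → Adversary m n Σ → List (Cell m n) → History m n Σ
run A qs = runFrom A [] qs

Extends : ∀ {m n Σ} → Coloring m n Σ → History m n Σ → Set
Extends c h = ∀ {x a} → (x , a) ∈ h → c x ≡ a

-- Tile the 2p × 2q grid by its p·q aligned 2 × 2 blocks and colour the blocks like a
-- checkerboard (blockParity).  A block of parity b owns two symbols, (b, false) "open" and
-- (b, true) "closing".  The adversary answers every cell with the open symbol of its block,
-- except the last cell of a block to be queried, which gets the closing symbol.
-- While some cell y is unread no cell of y's block is closing, so giving every unread cell
-- its open symbol makes y's block monochromatic: a 4-cycle.  Letting the adversary answer
-- all remaining cells instead gives every block both of its symbols.  Adjacent cells of equal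
-- symbol have equal block parity, hence lie in the same block; since the grid is bipartite a
-- cycle has at least 4 cells, so it would fill a whole block, and no block is monochromatic.
module Submission where

open import Defs
open import Data.Bool using (Bool; true; false; not)
open import Data.Bool.Properties using (not-¬)
open import Data.Empty using (⊥; ⊥-elim)
open import Data.Fin as Fin using (Fin; toℕ; fromℕ<; inject≤)
open import Data.Fin.Patterns using (0F; 1F; 2F; 3F)
open import Data.Fin.Properties using (toℕ<n; toℕ-fromℕ<; toℕ-injective; inject≤-injective)
open import Data.List using (List; []; _∷_; _++_; [_]; length; map; filter; allFin; cartesianProduct)
open import Data.List.Membership.Propositional using (_∈_; _∉_)
open import Data.List.Membership.Propositional.Properties
  using (∈-map⁺; ∈-map⁻; ∈-++⁺ˡ; ∈-++⁺ʳ; ∈-++⁻; ∈-∃++; ∈-filter⁺; ∈-filter⁻;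
         ∈-cartesianProduct⁺; ∈-allFin)
open import Data.List.Properties
  using (length-++; length-++-sucʳ; length-map; length-tabulate; map-++; ++-assoc; ++-identityʳ)
open import Data.List.Relation.Binary.Subset.Propositional using (_⊆_)
open import Data.List.Relation.Unary.All as All using ([]; _∷_; all?)
open import Data.List.Relation.Unary.All.Properties using (¬All⇒Any¬; ¬Any⇒All¬)
open import Data.List.Relation.Unary.Any using (here; there; satisfied; any?)
open import Data.List.Relation.Unary.AllPairs using ([]; _∷_)
open import Data.List.Relation.Unary.Linked as Linked using ([-]; _∷_)
open import Data.List.Relation.Unary.Linked.Properties using (Linked⇒All)
open import Data.List.Relation.Unary.Unique.Propositional using (Unique)
open import Data.List.Relation.Unary.Unique.Propositional.Properties
  using (++⁺; filter⁺; cartesianProduct⁺; allFin⁺)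
open import Data.Nat using (ℕ; zero; suc; _+_; _*_; _≤_; _<_; z≤n; s≤s; _≟_; ⌊_/2⌋; ∣_-_∣; parity)
open import Data.Nat.Properties
  using (∣n-n∣≡0; ∣m-n∣≡0⇒m≡n; ∣-∣-comm; ≤-trans; ≤-reflexive; <⇒≱; suc-injective)
open import Data.Parity using (Parity; 0ℙ; 1ℙ; _⁻¹)
open import Data.Parity.Properties using (suc-homo-⁻¹; ⁻¹-selfInverse; ⁻¹-involutive; p≢p⁻¹; *-homo-*)
open import Data.Product using (_×_; _,_; proj₁; proj₂; ∃-syntax)
open import Data.Product.Properties using (,-injective; ≡-dec)
open import Data.Sum using (_⊎_; inj₁; inj₂)
open import Function using (_∘_; id)
open import Function.Definitions using (Injective)
open import Relation.Binary.Definitions using (DecidableEquality)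
open import Relation.Binary.PropositionalEquality hiding ([_])
open import Relation.Nullary using (Dec; yes; no; does; proof; ¬?; contradiction)
open import Relation.Nullary.Decidable using (map′)
open import Relation.Nullary.Reflects using (Reflects; ofʸ; ofⁿ)

data Neighbours : ℕ → ℕ → Set where
  up   : ∀ {n} → Neighbours n (suc n)
  down : ∀ {n} → Neighbours (suc n) n

Neighbours-sym : ∀ {m n} → Neighbours m n → Neighbours n m
Neighbours-sym up   = down
Neighbours-sym down = up

Neighbours-suc : ∀ {m n} → Neighbours m n → Neighbours (suc m) (suc n)
Neighbours-suc up   = up
Neighbours-suc down = down

Neighbours-+ˡ : ∀ k {m n} → Neighbours m n → Neighbours (k + m) (k + n)
Neighbours-+ˡ zero    mn = mn
Neighbours-+ˡ (suc k) mn = Neighbours-suc (Neighbours-+ˡ k mn)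

Neighbours-+ʳ : ∀ k {m n} → Neighbours m n → Neighbours (m + k) (n + k)
Neighbours-+ʳ k up   = up
Neighbours-+ʳ k down = down

∣m-n∣≡1⇒Neighbours : ∀ m n → ∣ m - n ∣ ≡ 1 → Neighbours m n
∣m-n∣≡1⇒Neighbours zero       (suc zero) _ = up
∣m-n∣≡1⇒Neighbours (suc zero) zero       _ = down
∣m-n∣≡1⇒Neighbours (suc m)    (suc n)    e = Neighbours-suc (∣m-n∣≡1⇒Neighbours m n e)

∣n-1+n∣≡1 : ∀ n → ∣ n - suc n ∣ ≡ 1
∣n-1+n∣≡1 zero    = refl
∣n-1+n∣≡1 (suc n) = ∣n-1+n∣≡1 n

Neighbours⇒∣m-n∣≡1 : ∀ {m n} → Neighbours m n → ∣ m - n ∣ ≡ 1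
Neighbours⇒∣m-n∣≡1 {m}     up   = ∣n-1+n∣≡1 m
Neighbours⇒∣m-n∣≡1 {n = n} down = trans (∣-∣-comm (suc n) n) (∣n-1+n∣≡1 n)

parity-suc : ∀ n → parity (suc n) ≡ parity n ⁻¹
parity-suc n = sym (⁻¹-selfInverse (suc-homo-⁻¹ n))

parity-Neighbours : ∀ {m n} → Neighbours m n → parity n ≡ parity m ⁻¹
parity-Neighbours {m}     up   = parity-suc m
parity-Neighbours {n = n} down = trans (sym (⁻¹-involutive (parity n))) (cong _⁻¹ (sym (parity-suc n)))

⌊n/2⌋-⌊1+n/2⌋ : ∀ n → ⌊ n /2⌋ ≡ ⌊ suc n /2⌋ ⊎ Neighbours ⌊ n /2⌋ ⌊ suc n /2⌋
⌊n/2⌋-⌊1+n/2⌋ zero          = inj₁ refl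
⌊n/2⌋-⌊1+n/2⌋ (suc zero)    = inj₂ up
⌊n/2⌋-⌊1+n/2⌋ (suc (suc n)) with ⌊n/2⌋-⌊1+n/2⌋ n
... | inj₁ eq = inj₁ (cong suc eq)
... | inj₂ nb = inj₂ (Neighbours-suc nb)

⌊/2⌋-Neighbours : ∀ {m n} → Neighbours m n → ⌊ m /2⌋ ≡ ⌊ n /2⌋ ⊎ Neighbours ⌊ m /2⌋ ⌊ n /2⌋
⌊/2⌋-Neighbours {m} up = ⌊n/2⌋-⌊1+n/2⌋ m
⌊/2⌋-Neighbours {n = n} down with ⌊n/2⌋-⌊1+n/2⌋ n
... | inj₁ eq = inj₁ (sym eq)
... | inj₂ nb = inj₂ (Neighbours-sym nb)

partner : ℕ → ℕ
partner zero          = 1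
partner (suc zero)    = 0
partner (suc (suc n)) = suc (suc (partner n))

Neighbours-partner : ∀ n → Neighbours n (partner n)
Neighbours-partner zero          = up
Neighbours-partner (suc zero)    = down
Neighbours-partner (suc (suc n)) = Neighbours-suc (Neighbours-suc (Neighbours-partner n))

partner-≢ : ∀ n → partner n ≢ n
partner-≢ n eq = p≢p⁻¹ (parity n) (trans (cong parity (sym eq)) (parity-Neighbours (Neighbours-partner n)))

⌊partner/2⌋ : ∀ n → ⌊ partner n /2⌋ ≡ ⌊ n /2⌋
⌊partner/2⌋ zero          = refl
⌊partner/2⌋ (suc zero)    = refl
⌊partner/2⌋ (suc (suc n)) = cong suc (⌊partner/2⌋ n)

partner-< : ∀ {m} n → n < m → parity m ≡ 0ℙ → partner n < m
partner-< {suc (suc m)} zero          _                 _    = s≤s (s≤s z≤n)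
partner-< {suc m}       (suc zero)    _                 _    = s≤s z≤n
partner-< {suc (suc m)} (suc (suc n)) (s≤s (s≤s n<m)) even = s≤s (s≤s (partner-< n n<m even))

⌊/2⌋-injective-upTo-partner : ∀ m n → ⌊ m /2⌋ ≡ ⌊ n /2⌋ → m ≡ n ⊎ m ≡ partner n
⌊/2⌋-injective-upTo-partner zero          zero          _  = inj₁ refl
⌊/2⌋-injective-upTo-partner zero          (suc zero)    _  = inj₂ refl
⌊/2⌋-injective-upTo-partner (suc zero)    zero          _  = inj₂ refl
⌊/2⌋-injective-upTo-partner (suc zero)    (suc zero)    _  = inj₁ refl
⌊/2⌋-injective-upTo-partner (suc (suc m)) (suc (suc n)) eq
  with ⌊/2⌋-injective-upTo-partner m n (suc-injective eq)
... | inj₁ m≡n  = inj₁ (cong (suc ∘ suc) m≡n)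
... | inj₂ m≡n′ = inj₂ (cong (suc ∘ suc) m≡n′)

data Adjacent : ℕ × ℕ → ℕ × ℕ → Set where
  vertical   : ∀ {a a′ b} → Neighbours a a′ → Adjacent (a , b) (a′ , b)
  horizontal : ∀ {a b b′} → Neighbours b b′ → Adjacent (a , b) (a , b′)

∣-∣+∣-∣≡1⇒Adjacent : ∀ a a′ b b′ → ∣ a - a′ ∣ + ∣ b - b′ ∣ ≡ 1 →
  Adjacent (a , b) (a′ , b′)
∣-∣+∣-∣≡1⇒Adjacent a a′ b b′ e with ∣ a - a′ ∣ in da | ∣ b - b′ ∣ in db
... | 0 | _ with refl ← ∣m-n∣≡0⇒m≡n {a} {a′} da =
  horizontal (∣m-n∣≡1⇒Neighbours b b′ (trans db e))
... | 1 | 0 with refl ← ∣m-n∣≡0⇒m≡n {b} {b′} db =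
  vertical (∣m-n∣≡1⇒Neighbours a a′ da)

parity₂ : ℕ × ℕ → Parity
parity₂ (a , b) = parity (a + b)

parity₂-Adjacent : ∀ {u v} → Adjacent u v → parity₂ v ≡ parity₂ u ⁻¹
parity₂-Adjacent (vertical {b = b} nb) = parity-Neighbours (Neighbours-+ʳ b nb)
parity₂-Adjacent (horizontal {a} nb)   = parity-Neighbours (Neighbours-+ˡ a nb)

Adjacent-no-triangle : ∀ {u v w} → Adjacent u v → Adjacent v w → Adjacent w u → ⊥
Adjacent-no-triangle {u} {v} {w} uv vw wu = p≢p⁻¹ (parity₂ u) (begin
  parity₂ u       ≡⟨ parity₂-Adjacent wu ⟩
  parity₂ w ⁻¹    ≡⟨ cong _⁻¹ (parity₂-Adjacent vw) ⟩
  parity₂ v ⁻¹ ⁻¹ ≡⟨ ⁻¹-involutive (parity₂ v) ⟩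
  parity₂ v       ≡⟨ parity₂-Adjacent uv ⟩
  parity₂ u ⁻¹    ∎)
  where open ≡-Reasoning

halve : ℕ × ℕ → ℕ × ℕ
halve (a , b) = ⌊ a /2⌋ , ⌊ b /2⌋

halve-Adjacent : ∀ {u v} → Adjacent u v → halve u ≡ halve v ⊎ Adjacent (halve u) (halve v)
halve-Adjacent (vertical {b = b} nb) with ⌊/2⌋-Neighbours nb
... | inj₁ eq  = inj₁ (cong (_, ⌊ b /2⌋) eq)
... | inj₂ nb′ = inj₂ (vertical nb′)
halve-Adjacent (horizontal {a} nb) with ⌊/2⌋-Neighbours nb
... | inj₁ eq  = inj₁ (cong (⌊ a /2⌋ ,_) eq)
... | inj₂ nb′ = inj₂ (horizontal nb′)

Adjacent-sameParity⇒sameHalves : ∀ {u v} → Adjacent u v →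
  parity₂ (halve u) ≡ parity₂ (halve v) → halve u ≡ halve v
Adjacent-sameParity⇒sameHalves uv same with halve-Adjacent uv
... | inj₁ eq  = eq
... | inj₂ uv′ = ⊥-elim (p≢p⁻¹ _ (trans same (parity₂-Adjacent uv′)))

module FinPartner (r : ℕ) where

  parity[2r]≡0ℙ : parity (2 * r) ≡ 0ℙ
  parity[2r]≡0ℙ = *-homo-* 2 r

  partnerFin : Fin (2 * r) → Fin (2 * r)
  partnerFin i = fromℕ< (partner-< (toℕ i) (toℕ<n i) parity[2r]≡0ℙ)

  toℕ-partnerFin : ∀ i → toℕ (partnerFin i) ≡ partner (toℕ i)
  toℕ-partnerFin i = toℕ-fromℕ< _

  partnerFin-≢ : ∀ i → partnerFin i ≢ i
  partnerFin-≢ i eq = partner-≢ (toℕ i) (trans (sym (toℕ-partnerFin i)) (cong toℕ eq))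

  ⌊partnerFin/2⌋ : ∀ i → ⌊ toℕ (partnerFin i) /2⌋ ≡ ⌊ toℕ i /2⌋
  ⌊partnerFin/2⌋ i = trans (cong ⌊_/2⌋ (toℕ-partnerFin i)) (⌊partner/2⌋ (toℕ i))

  ∣i-partnerFin∣≡1 : ∀ i → ∣ toℕ i - toℕ (partnerFin i) ∣ ≡ 1
  ∣i-partnerFin∣≡1 i = trans (cong (∣ toℕ i -_∣) (toℕ-partnerFin i))
                             (Neighbours⇒∣m-n∣≡1 (Neighbours-partner (toℕ i)))

  ⌊/2⌋-injective-upTo-partnerFin : ∀ i j → ⌊ toℕ i /2⌋ ≡ ⌊ toℕ j /2⌋ →
    i ≡ j ⊎ i ≡ partnerFin j
  ⌊/2⌋-injective-upTo-partnerFin i j eq with ⌊/2⌋-injective-upTo-partner (toℕ i) (toℕ j) eq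
  ... | inj₁ i≡j  = inj₁ (toℕ-injective i≡j)
  ... | inj₂ i≡j′ = inj₂ (toℕ-injective (trans i≡j′ (sym (toℕ-partnerFin j))))

Unique-⊆⇒length≤ : ∀ {A : Set} {xs ys : List A} → Unique xs → xs ⊆ ys → length xs ≤ length ys
Unique-⊆⇒length≤ [] _ = z≤n
Unique-⊆⇒length≤ {xs = x ∷ xs} (x∉xs ∷ unique) xs⊆ys with ∈-∃++ (xs⊆ys (here refl))
... | as , bs , refl =
  ≤-trans (s≤s (Unique-⊆⇒length≤ unique xs⊆as++bs)) (≤-reflexive (sym (length-++-sucʳ as x bs)))
  where
    xs⊆as++bs : xs ⊆ as ++ bs
    xs⊆as++bs y∈xs with ∈-++⁻ as (xs⊆ys (there y∈xs))
    ... | inj₁ y∈as         = ∈-++⁺ˡ y∈as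
    ... | inj₂ (here refl)  = contradiction refl (All.lookup x∉xs y∈xs)
    ... | inj₂ (there y∈bs) = ∈-++⁺ʳ as y∈bs

Unique-++⇒∉ : ∀ {A : Set} (xs : List A) {x ys} → Unique (xs ++ x ∷ ys) → x ∉ xs
Unique-++⇒∉ (y ∷ xs) (y∉ ∷ _)      (here refl) =
  contradiction refl (All.lookup y∉ (∈-++⁺ʳ xs (here refl)))
Unique-++⇒∉ (y ∷ xs) (_ ∷ unique) (there x∈)  = Unique-++⇒∉ xs unique x∈

length-cartesianProduct : ∀ {A B : Set} (xs : List A) (ys : List B) →
  length (cartesianProduct xs ys) ≡ length xs * length ys
length-cartesianProduct []       ys = refl
length-cartesianProduct (x ∷ xs) ys = trans (length-++ (map (x ,_) ys))
  (cong₂ _+_ (length-map (x ,_) ys) (length-cartesianProduct xs ys))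

module _ {m n : ℕ} where

  _≟ᶜ_ : DecidableEquality (Cell m n)
  _≟ᶜ_ = ≡-dec Fin._≟_ Fin._≟_

  _∈?_ : ∀ (x : Cell m n) xs → Dec (x ∈ xs)
  x ∈? xs = any? (x ≟ᶜ_) xs

  allCells : List (Cell m n)
  allCells = cartesianProduct (allFin m) (allFin n)

  ∈-allCells : ∀ x → x ∈ allCells
  ∈-allCells (i , j) = ∈-cartesianProduct⁺ (∈-allFin i) (∈-allFin j)

  allCells-unique : Unique allCells
  allCells-unique = cartesianProduct⁺ (allFin⁺ m) (allFin⁺ n)

  length-allCells : length allCells ≡ m * n
  length-allCells = trans (length-cartesianProduct (allFin m) (allFin n))
                          (cong₂ _*_ (length-tabulate {n = m} id) (length-tabulate {n = n} id))

  ∃-unqueried : ∀ xs → length xs < m * n → ∃[ y ] y ∉ xs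
  ∃-unqueried xs short with all? (_∈? xs) allCells
  ... | yes all∈ = contradiction (Unique-⊆⇒length≤ allCells-unique (All.lookup all∈))
                                 (<⇒≱ (subst (length xs <_) (sym length-allCells) short))
  ... | no ¬all∈ = satisfied (¬All⇒Any¬ (_∈? xs) allCells ¬all∈)

  ∃-completion : ∀ xs → Unique xs → ∃[ ys ] Unique (xs ++ ys) × (∀ x → x ∈ xs ++ ys)
  ∃-completion xs unique = unqueried , ++⁺ unique (filter⁺ new? {allCells} allCells-unique) disjoint , covered
    where
      new? : ∀ x → Dec (x ∉ xs)
      new? x = ¬? (x ∈? xs)

      unqueried : List (Cell m n)
      unqueried = filter new? allCells

      disjoint : ∀ {x} → x ∈ xs × x ∈ unqueried → ⊥
      disjoint (x∈xs , x∈) = proj₂ (∈-filter⁻ new? {xs = allCells} x∈) x∈xs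

      covered : ∀ x → x ∈ xs ++ unqueried
      covered x with x ∈? xs
      ... | yes x∈xs = ∈-++⁺ˡ x∈xs
      ... | no  x∉xs = ∈-++⁺ʳ xs (∈-filter⁺ new? (∈-allCells x) x∉xs)

  module _ {Σ : Set} where

    queried : History m n Σ → List (Cell m n)
    queried = map proj₁

    queried-snoc : ∀ h e → queried (h ++ [ e ]) ≡ queried h ++ [ proj₁ e ]
    queried-snoc h e = map-++ proj₁ h [ e ]

    queried-snoc-++ : ∀ h e xs → queried (h ++ [ e ]) ++ xs ≡ queried h ++ proj₁ e ∷ xs
    queried-snoc-++ h e xs = trans (cong (_++ xs) (queried-snoc h e)) (++-assoc (queried h) [ proj₁ e ] xs)

    recorded : ∀ {x h} → x ∈ queried h → ∃[ a ] (x , a) ∈ h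
    recorded x∈ with ∈-map⁻ proj₁ x∈
    ... | (_ , a) , e∈h , refl = a , e∈h

    answers-functional : ∀ {h x a b} → Unique (queried h) → (x , a) ∈ h → (x , b) ∈ h → a ≡ b
    answers-functional _            (here refl) (here refl)  = refl
    answers-functional (x∉ ∷ _)     (here refl) (there e∈)   =
      contradiction refl (All.lookup x∉ (∈-map⁺ proj₁ e∈))
    answers-functional (x∉ ∷ _)     (there e∈)  (here refl)  =
      contradiction refl (All.lookup x∉ (∈-map⁺ proj₁ e∈))
    answers-functional (_ ∷ unique) (there e∈)  (there e∈′) = answers-functional unique e∈ e∈′

    completion : History m n Σ → Coloring m n Σ → Coloring m n Σ
    completion h default x with x ∈? queried h
    ... | yes x∈ = proj₁ (recorded x∈)
    ... | no  _  = default x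

    completion-∈ : ∀ {h default x} → x ∈ queried h → (x , completion h default x) ∈ h
    completion-∈ {h} {x = x} x∈ with x ∈? queried h
    ... | yes x∈′ = proj₂ (recorded x∈′)
    ... | no  x∉  = contradiction x∈ x∉

    completion-∉ : ∀ {h default x} → x ∉ queried h → completion h default x ≡ default x
    completion-∉ {h} {x = x} x∉ with x ∈? queried h
    ... | yes x∈ = contradiction x∈ x∉
    ... | no  _  = refl

    completion-extends : ∀ {h h′ default} → Unique (queried h) → h′ ⊆ h →
      Extends (completion h default) h′
    completion-extends unique h′⊆h e∈ =
      answers-functional unique (completion-∈ (∈-map⁺ proj₁ (h′⊆h e∈))) (h′⊆h e∈)

    module _ (A : Adversary m n Σ) where

      queried-runFrom : ∀ h xs → queried (runFrom A h xs) ≡ queried h ++ xs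
      queried-runFrom h []       = sym (++-identityʳ (queried h))
      queried-runFrom h (x ∷ xs) =
        trans (queried-runFrom _ xs) (queried-snoc-++ h (x , A h x) xs)

      runFrom-++ : ∀ h xs ys → runFrom A h (xs ++ ys) ≡ runFrom A (runFrom A h xs) ys
      runFrom-++ h []       ys = refl
      runFrom-++ h (x ∷ xs) ys = runFrom-++ _ xs ys

      runFrom-⊇ : ∀ h xs → h ⊆ runFrom A h xs
      runFrom-⊇ h []       e∈ = e∈
      runFrom-⊇ h (x ∷ xs) e∈ = runFrom-⊇ _ xs (∈-++⁺ˡ e∈)

      runFrom-preserves : (P : History m n Σ → Set) →
        (∀ {h x} → P h → x ∉ queried h → P (h ++ [ (x , A h x) ])) →
        ∀ {h} xs → P h → Unique (queried h ++ xs) → P (runFrom A h xs)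
      runFrom-preserves P step     []       Ph _      = Ph
      runFrom-preserves P step {h} (x ∷ xs) Ph unique =
        runFrom-preserves P step xs (step Ph (Unique-++⇒∉ (queried h) unique))
          (subst Unique (sym (queried-snoc-++ h (x , A h x) xs)) unique)

module Grid (p q : ℕ) where

  module Row = FinPartner p
  module Col = FinPartner q

  GridCell : Set
  GridCell = Cell (2 * p) (2 * q)

  coords : GridCell → ℕ × ℕ
  coords (i , j) = toℕ i , toℕ j

  block : GridCell → ℕ × ℕ
  block x = halve (coords x)

  blockParity : GridCell → Parity
  blockParity x = parity₂ (block x)

  GridAdj⇒Adjacent : ∀ (u v : GridCell) → GridAdj u v → Adjacent (coords u) (coords v)
  GridAdj⇒Adjacent (i , j) (i′ , j′) =
    ∣-∣+∣-∣≡1⇒Adjacent (toℕ i) (toℕ i′) (toℕ j) (toℕ j′)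

  GridAdj-sym : ∀ (u v : GridCell) → GridAdj u v → GridAdj v u
  GridAdj-sym (i , j) (i′ , j′) =
    subst (_≡ 1) (cong₂ _+_ (∣-∣-comm (toℕ i) (toℕ i′)) (∣-∣-comm (toℕ j) (toℕ j′)))

  GridAdj-no-triangle : ∀ (u v w : GridCell) → GridAdj u v → GridAdj v w → GridAdj w u → ⊥
  GridAdj-no-triangle u v w uv vw wu =
    Adjacent-no-triangle (GridAdj⇒Adjacent u v uv) (GridAdj⇒Adjacent v w vw) (GridAdj⇒Adjacent w u wu)

  GridAdj-sameBlockParity⇒sameBlock : ∀ (u v : GridCell) → GridAdj u v →
    blockParity u ≡ blockParity v → block u ≡ block v
  GridAdj-sameBlockParity⇒sameBlock u v uv = Adjacent-sameParity⇒sameHalves (GridAdj⇒Adjacent u v uv)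

  flipRow flipCol : GridCell → GridCell
  flipRow (i , j) = Row.partnerFin i , j
  flipCol (i , j) = i , Col.partnerFin j

  GridAdj-flipRow : ∀ x → GridAdj x (flipRow x)
  GridAdj-flipRow (i , j) = cong₂ _+_ (Row.∣i-partnerFin∣≡1 i) (∣n-n∣≡0 (toℕ j))

  GridAdj-flipCol : ∀ x → GridAdj x (flipCol x)
  GridAdj-flipCol (i , j) = cong₂ _+_ (∣n-n∣≡0 (toℕ i)) (Col.∣i-partnerFin∣≡1 j)

  flipRow-≢ : ∀ x → flipRow x ≢ x
  flipRow-≢ (i , _) = Row.partnerFin-≢ i ∘ cong proj₁

  block-flipRow : ∀ x → block (flipRow x) ≡ block x
  block-flipRow (i , j) = cong (_, ⌊ toℕ j /2⌋) (Row.⌊partnerFin/2⌋ i)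

  block-flipCol : ∀ x → block (flipCol x) ≡ block x
  block-flipCol (i , j) = cong (⌊ toℕ i /2⌋ ,_) (Col.⌊partnerFin/2⌋ j)

  blockCells : GridCell → List GridCell
  blockCells x = x ∷ flipRow x ∷ flipCol (flipRow x) ∷ flipCol x ∷ []

  ∈-blockCells⇒block : ∀ {w x} → w ∈ blockCells x → block w ≡ block x
  ∈-blockCells⇒block         (here refl)                         = refl
  ∈-blockCells⇒block {x = x} (there (here refl))                 = block-flipRow x
  ∈-blockCells⇒block {x = x} (there (there (here refl)))         =
    trans (block-flipCol (flipRow x)) (block-flipRow x)
  ∈-blockCells⇒block {x = x} (there (there (there (here refl)))) = block-flipCol x

  block⇒∈-blockCells : ∀ {w x} → block w ≡ block x → w ∈ blockCells x
  block⇒∈-blockCells {i′ , j′} {i , j} eq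
    with Row.⌊/2⌋-injective-upTo-partnerFin i′ i (cong proj₁ eq)
       | Col.⌊/2⌋-injective-upTo-partnerFin j′ j (cong proj₂ eq)
  ... | inj₁ refl | inj₁ refl = here refl
  ... | inj₂ refl | inj₁ refl = there (here refl)
  ... | inj₂ refl | inj₂ refl = there (there (here refl))
  ... | inj₁ refl | inj₂ refl = there (there (there (here refl)))

  blockCells-unique : ∀ x → Unique (blockCells x)
  blockCells-unique (i , j) =
      (rowsDiffer i≢i′ ∷ rowsDiffer i≢i′ ∷ colsDiffer j≢j′ ∷ [])
    ∷ (colsDiffer j≢j′ ∷ rowsDiffer (i≢i′ ∘ sym) ∷ [])
    ∷ (rowsDiffer (i≢i′ ∘ sym) ∷ [])
    ∷ []
    ∷ []
    where
      i≢i′ : i ≢ Row.partnerFin i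
      i≢i′ = Row.partnerFin-≢ i ∘ sym

      j≢j′ : j ≢ Col.partnerFin j
      j≢j′ = Col.partnerFin-≢ j ∘ sym

      rowsDiffer : ∀ {u v : GridCell} → proj₁ u ≢ proj₁ v → u ≢ v
      rowsDiffer ne = ne ∘ cong proj₁

      colsDiffer : ∀ {u v : GridCell} → proj₂ u ≢ proj₂ v → u ≢ v
      colsDiffer ne = ne ∘ cong proj₂

  module _ {Σ : Set} {c : Coloring (2 * p) (2 * q) Σ} where

    block-constant⇒HasCycle : ∀ {a} x → (∀ {w} → block w ≡ block x → c w ≡ a) → HasCycle c
    block-constant⇒HasCycle x constant
      with All.tabulate {xs = blockCells x} (constant ∘ ∈-blockCells⇒block)
    ... | c₀ ∷ c₁ ∷ c₂ ∷ c₃ ∷ [] =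
        x , x₁ ∷ x₂ ∷ x₃ ∷ [] , blockCells-unique x , s≤s (s≤s z≤n)
      , (GridAdj-flipRow x                      , trans c₀ (sym c₁))
      ∷ (GridAdj-flipCol x₁                     , trans c₁ (sym c₂))
      ∷ (GridAdj-sym x₃ x₂ (GridAdj-flipRow x₃) , trans c₂ (sym c₃))
      ∷ (GridAdj-sym x x₃ (GridAdj-flipCol x)   , trans c₃ (sym c₀))
      ∷ [-]
      where
        x₁ x₂ x₃ : GridCell
        x₁ = flipRow x
        x₂ = flipCol x₁
        x₃ = flipCol x

    EdgesWithinBlocks : Set
    EdgesWithinBlocks = ∀ (u v : GridCell) → Edge c u v → block u ≡ block v

    NoMonochromaticBlock : Set
    NoMonochromaticBlock = ∀ x → ∃[ w ] block w ≡ block x × c w ≢ c x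

    acyclic : EdgesWithinBlocks → NoMonochromaticBlock → Acyclic c
    acyclic _ _ (_ , [] , _ , () , _)
    acyclic _ _ (_ , _ ∷ [] , _ , s≤s () , _)
    acyclic _ _ (u , v ∷ w ∷ [] , _ , _ , uv ∷ vw ∷ wu ∷ [-]) =
      GridAdj-no-triangle u v w (proj₁ uv) (proj₁ vw) (proj₁ wu)
    acyclic within bichromatic (v , vs@(_ ∷ _ ∷ _ ∷ _) , unique , _ , edges) with bichromatic v
    ... | w , bw , cw≢cv =
      -- w is off the cycle, so w and the at least 4 cycle cells are 5 distinct cells of v's block.
      contradiction (Unique-⊆⇒length≤ (¬Any⇒All¬ _ w∉cycle ∷ unique) cycle⊆block)
                    λ { (s≤s (s≤s (s≤s (s≤s ())))) }
      where
        Alike : GridCell → GridCell → Set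
        Alike u u′ = block u ≡ block u′ × c u ≡ c u′

        alike-trans : ∀ {u u′ u″} → Alike u u′ → Alike u′ u″ → Alike u u″
        alike-trans (b , k) (b′ , k′) = trans b b′ , trans k k′

        alikeV : ∀ {u} → u ∈ v ∷ vs → Alike v u
        alikeV u∈ = All.lookup (Linked⇒All alike-trans (refl , refl) (Linked.map alike edges)) (∈-++⁺ˡ u∈)
          where
            alike : ∀ {u u′} → Edge c u u′ → Alike u u′
            alike {u} {u′} e = within u u′ e , proj₂ e

        w∉cycle : w ∉ v ∷ vs
        w∉cycle w∈ = cw≢cv (sym (proj₂ (alikeV w∈)))

        cycle⊆block : w ∷ v ∷ vs ⊆ blockCells v
        cycle⊆block (here refl) = block⇒∈-blockCells bw
        cycle⊆block (there u∈)  = block⇒∈-blockCells (sym (proj₁ (alikeV u∈)))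

module BlockAdversary (p q : ℕ) {Σ : Set}
                      (paint : Parity × Bool → Σ) (paint-injective : Injective _≡_ _≡_ paint) where

  open Grid p q

  GridHistory : Set
  GridHistory = History (2 * p) (2 * q) Σ

  colour : GridCell → Bool → Σ
  colour x closing = paint (blockParity x , closing)

  openColour : GridCell → Σ
  openColour x = colour x false

  colour-block : ∀ {u v} s → block u ≡ block v → colour u s ≡ colour v s
  colour-block s eq = cong (λ b → paint (parity₂ b , s)) eq

  colour-injective : ∀ u v {s t} → colour u s ≡ colour v t → blockParity u ≡ blockParity v × s ≡ t
  colour-injective _ _ eq = ,-injective (paint-injective eq)

  BlockQueried : List GridCell → GridCell → Set
  BlockQueried xs x = ∀ {u} → block u ≡ block x → u ∈ xs

  blockQueried? : ∀ xs x → Dec (BlockQueried xs x)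
  blockQueried? xs x = map′ (λ all∈ bu → All.lookup all∈ (block⇒∈-blockCells bu))
                            (λ bq → All.tabulate (bq ∘ ∈-blockCells⇒block))
                            (all? (_∈? xs) (blockCells x))

  adversary : Adversary (2 * p) (2 * q) Σ
  adversary h x = colour x (does (blockQueried? (queried h ++ [ x ]) x))

  record Consistent (h : GridHistory) : Set where
    field
      coloured : ∀ {x a} → (x , a) ∈ h → ∃[ s ] a ≡ colour x s
      closing  : ∀ {x} → (x , colour x true) ∈ h → BlockQueried (queried h) x
      mixed    : ∀ {x} → BlockQueried (queried h) x →
                 ∀ s → ∃[ w ] block w ≡ block x × (w , colour x s) ∈ h

  open Consistent

  Consistent-[] : Consistent []
  Consistent-[] = record
    { coloured = λ ()
    ; closing  = λ ()
    ; mixed    = λ bq _ → contradiction (bq refl) λ ()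
    }

  unfinishedBlock⇒open : ∀ {h w a y} → Consistent h → (w , a) ∈ h →
    y ∉ queried h → block y ≡ block w → a ≡ openColour w
  unfinishedBlock⇒open inv e∈ y∉ by with coloured inv e∈
  ... | false , refl = refl
  ... | true  , refl = contradiction (closing inv e∈ by) y∉

  module _ {h : GridHistory} {x : GridCell} (inv : Consistent h) (x∉ : x ∉ queried h) where

    private
      h⁺ : Bool → GridHistory
      h⁺ s = h ++ [ (x , colour x s) ]

      Closes : Bool → Set
      Closes = Reflects (BlockQueried (queried h ++ [ x ]) x)

      ∈-queried-h⁺ : ∀ {s u} → u ∈ queried h ++ [ x ] → u ∈ queried (h⁺ s)
      ∈-queried-h⁺ = subst (_ ∈_) (sym (queried-snoc h _))

      ∈-queried-h⁺⁻ : ∀ {s u} → u ∈ queried (h⁺ s) → u ∈ queried h ⊎ u ≡ x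
      ∈-queried-h⁺⁻ {u = u} u∈ with ∈-++⁻ (queried h) (subst (u ∈_) (queried-snoc h _) u∈)
      ... | inj₁ old        = inj₁ old
      ... | inj₂ (here u≡x) = inj₂ u≡x

    coloured-step : ∀ {s y b} → (y , b) ∈ h⁺ s → ∃[ t ] b ≡ colour y t
    coloured-step {s} e∈ with ∈-++⁻ h e∈
    ... | inj₁ old         = coloured inv old
    ... | inj₂ (here refl) = s , refl

    closing-step : ∀ {s y} → Closes s → (y , colour y true) ∈ h⁺ s → BlockQueried (queried (h⁺ s)) y
    closing-step closes e∈ with ∈-++⁻ h e∈
    ... | inj₁ old = ∈-queried-h⁺ ∘ ∈-++⁺ˡ ∘ closing inv old
    ... | inj₂ (here eq) with ,-injective eq
    ...   | refl , same with proj₂ (colour-injective x x same) | closes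
    ...     | refl | ofʸ bq = ∈-queried-h⁺ ∘ bq

    mixed-elsewhere : ∀ {s z} → block x ≢ block z → BlockQueried (queried (h⁺ s)) z →
      ∀ t → ∃[ w ] block w ≡ block z × (w , colour z t) ∈ h⁺ s
    mixed-elsewhere {z = z} bx≢bz bq⁺ t = let w , bw , w∈ = mixed inv bq t in w , bw , ∈-++⁺ˡ w∈
      where
        bq : BlockQueried (queried h) z
        bq bu with ∈-queried-h⁺⁻ (bq⁺ bu)
        ... | inj₁ u∈   = u∈
        ... | inj₂ refl = contradiction bu bx≢bz

    -- x is the last cell of block z: it is answered closing, while its row partner was answered
    -- before x was read, hence open.
    mixed-completed : ∀ {s z} → Closes s → block x ≡ block z → BlockQueried (queried (h⁺ s)) z →
      ∀ t → ∃[ w ] block w ≡ block z × (w , colour z t) ∈ h⁺ s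
    mixed-completed (ofⁿ ¬bq) bx≡bz bq⁺ _ =
      contradiction (λ {u} bu → subst (u ∈_) (queried-snoc h _) (bq⁺ (trans bu bx≡bz))) ¬bq
    mixed-completed (ofʸ _) bx≡bz bq⁺ true =
      x , bx≡bz , ∈-++⁺ʳ h (here (cong (x ,_) (colour-block true (sym bx≡bz))))
    mixed-completed {z = z} (ofʸ _) bx≡bz bq⁺ false =
      w , bw≡bz , ∈-++⁺ˡ (subst (λ a → (w , a) ∈ h) (trans w-open (colour-block false bw≡bz)) w∈h)
      where
        w : GridCell
        w = flipRow x

        bw≡bz : block w ≡ block z
        bw≡bz = trans (block-flipRow x) bx≡bz

        w∈queried : w ∈ queried h
        w∈queried with ∈-queried-h⁺⁻ (bq⁺ bw≡bz)
        ... | inj₁ w∈   = w∈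
        ... | inj₂ w≡x  = contradiction w≡x (flipRow-≢ x)

        w∈h : (w , proj₁ (recorded w∈queried)) ∈ h
        w∈h = proj₂ (recorded w∈queried)

        w-open : proj₁ (recorded w∈queried) ≡ openColour w
        w-open = unfinishedBlock⇒open inv w∈h x∉ (sym (block-flipRow x))

    Consistent-step : ∀ {s} → Closes s → Consistent (h⁺ s)
    Consistent-step closes = record
      { coloured = coloured-step
      ; closing  = closing-step closes
      ; mixed    = λ {z} → mixed-step z (≡-dec _≟_ _≟_ (block x) (block z))
      }
      where
        mixed-step : ∀ z → Dec (block x ≡ block z) → BlockQueried (queried (h⁺ _)) z →
          ∀ t → ∃[ w ] block w ≡ block z × (w , colour z t) ∈ h⁺ _
        mixed-step z (yes bx≡bz) = mixed-completed closes bx≡bz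
        mixed-step z (no  bx≢bz) = mixed-elsewhere bx≢bz

  Consistent-run : ∀ qs → Unique qs → Consistent (run adversary qs)
  Consistent-run qs = runFrom-preserves adversary Consistent
    (λ {h} {x} inv x∉ → Consistent-step inv x∉ (proof (blockQueried? (queried h ++ [ x ]) x))) qs Consistent-[]

  queried-run : ∀ qs → queried (run adversary qs) ≡ qs
  queried-run = queried-runFrom adversary []

  cyclic-completion : ∀ {h y} → Consistent h → y ∉ queried h → HasCycle (completion h openColour)
  cyclic-completion {h} {y} inv y∉ = block-constant⇒HasCycle y (λ {w} bw → open-in-block bw (w ∈? queried h))
    where
      open-in-block : ∀ {w} → block w ≡ block y → Dec (w ∈ queried h) →
        completion h openColour w ≡ openColour y
      open-in-block bw (yes w∈) =
        trans (unfinishedBlock⇒open inv (completion-∈ w∈) y∉ (sym bw)) (colour-block false bw)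
      open-in-block bw (no  w∉) = trans (completion-∉ w∉) (colour-block false bw)

  acyclic-completion : ∀ {h default} → Consistent h → Unique (queried h) → (∀ x → x ∈ queried h) →
    Acyclic (completion h default)
  acyclic-completion {h} {default} inv unique all∈ = acyclic edgesWithinBlocks noMonochromaticBlock
    where
      c : GridCell → Σ
      c = completion h default

      c-extends : Extends c h
      c-extends = completion-extends unique id

      colour-of : ∀ x → ∃[ s ] c x ≡ colour x s
      colour-of x = coloured inv (completion-∈ (all∈ x))

      edgesWithinBlocks : EdgesWithinBlocks
      edgesWithinBlocks u v (uv , same) with colour-of u | colour-of v
      ... | _ , cu | _ , cv =
        GridAdj-sameBlockParity⇒sameBlock u v uv (proj₁ (colour-injective u v (trans (sym cu) (trans same cv))))

      noMonochromaticBlock : NoMonochromaticBlock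
      noMonochromaticBlock x with colour-of x
      ... | s , cx with mixed inv (λ {u} _ → all∈ u) (not s)
      ...   | w , bw , w∈ = w , bw , λ cw≡cx →
        not-¬ refl (sym (proj₂ (colour-injective x x (trans (sym (c-extends w∈)) (trans cw≡cx cx)))))

  adversary-correct : ∀ qs → Unique qs → length qs < (2 * p) * (2 * q) →
    (∃[ c ] (Extends c (run adversary qs) × HasCycle c)) × (∃[ c ] (Extends c (run adversary qs) × Acyclic c))
  adversary-correct qs unique short with ∃-unqueried qs short | ∃-completion qs unique
  ... | y , y∉qs | rest , unique⁺ , all∈⁺ =
      (completion H openColour , completion-extends uniqueH id , cyclic-completion (Consistent-run qs unique) y∉H)
    , (completion H⁺ openColour , completion-extends uniqueH⁺ H⊆H⁺ ,
       acyclic-completion (Consistent-run (qs ++ rest) unique⁺) uniqueH⁺ all∈H⁺)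
    where
      H H⁺ : GridHistory
      H  = run adversary qs
      H⁺ = run adversary (qs ++ rest)

      uniqueH : Unique (queried H)
      uniqueH = subst Unique (sym (queried-run qs)) unique

      y∉H : y ∉ queried H
      y∉H = subst (y ∉_) (sym (queried-run qs)) y∉qs

      uniqueH⁺ : Unique (queried H⁺)
      uniqueH⁺ = subst Unique (sym (queried-run (qs ++ rest))) unique⁺

      all∈H⁺ : ∀ x → x ∈ queried H⁺
      all∈H⁺ x = subst (x ∈_) (sym (queried-run (qs ++ rest))) (all∈⁺ x)

      H⊆H⁺ : H ⊆ H⁺
      H⊆H⁺ = subst (H ⊆_) (sym (runFrom-++ adversary [] qs rest)) (runFrom-⊇ adversary H rest)

encode : Parity × Bool → Fin 4
encode (0ℙ , false) = 0F
encode (0ℙ , true)  = 1F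
encode (1ℙ , false) = 2F
encode (1ℙ , true)  = 3F

decode : Fin 4 → Parity × Bool
decode 0F = 0ℙ , false
decode 1F = 0ℙ , true
decode 2F = 1ℙ , false
decode 3F = 1ℙ , true

decode-encode : ∀ c → decode (encode c) ≡ c
decode-encode (0ℙ , false) = refl
decode-encode (0ℙ , true)  = refl
decode-encode (1ℙ , false) = refl
decode-encode (1ℙ , true)  = refl

palette : ∀ {k} → 4 ≤ k → Parity × Bool → Fin k
palette 4≤k c = inject≤ (encode c) 4≤k

palette-injective : ∀ {k} (4≤k : 4 ≤ k) → Injective _≡_ _≡_ (palette 4≤k)
palette-injective 4≤k {c} {d} eq = begin
  c                 ≡⟨ decode-encode c ⟨
  decode (encode c) ≡⟨ cong decode (inject≤-injective 4≤k 4≤k (encode c) (encode d) eq) ⟩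
  decode (encode d) ≡⟨ decode-encode d ⟩
  d                 ∎
  where open ≡-Reasoning

lemma5 : (p q k : ℕ) → 1 ≤ p → 1 ≤ q → 4 ≤ k →
    ∃[ A ] ((qs : List (Cell (2 * p) (2 * q))) → Unique qs →
      1 ≤ length qs → length qs < (2 * p) * (2 * q) →
      (∃[ c ] (Extends {2 * p} {2 * q} {Fin k} c (run A qs) × HasCycle c))
      × (∃[ c ] (Extends {2 * p} {2 * q} {Fin k} c (run A qs) × Acyclic c)))
lemma5 p q k _ _ 4≤k = adversary , λ qs unique _ → adversary-correct qs unique
  where open BlockAdversary p q (palette 4≤k) (palette-injective 4≤k)
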